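{- If $n$ is an almost-prime number, then $\gcd(n,\varphi(n))=1$.
   Context: For a positive integer $n$ with positive divisors $1=d_1<d_2<\dots<d_k=n$, define the polynomial $T_n(x)=x^{d_1}+x^{d_2}+\dots+x^{d_k}-kx$. A positive integer $n$ is called weakly almost-prime if $n\mid T_n(x)$ for all integers $x$; it is called almost-prime if it is weakly almost-prime and square-free. $\varphi$ is Euler's totient function. -}

module Defs where

open import Data.Nat as ℕ using (ℕ; zero; suc; _≥_)
open import Data.Nat.Divisibility as ℕD using (_∣?_)
open import Data.Nat.Coprimality using (coprime?)
open import Data.List using (List; filter; map; length; upTo)
open import Data.Integer as ℤ using (ℤ; +_)
open import Data.Integer.Divisibility as ℤD using ()
open import Data.Product using (_×_)
open import Relation.Binary.PropositionalEquality using (_≡_)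
import Data.List

range1 : ℕ → List ℕ
range1 n = map suc (upTo n)

divisors : ℕ → List ℕ
divisors n = filter (λ d → d ∣? n) (range1 n)

φ : ℕ → ℕ
φ n = length (filter (λ m → coprime? m n) (range1 n))

T : ℕ → ℤ → ℤ
T n x = sumℤ (map (λ d → x ℤ.^ d) (divisors n)) ℤ.- (+ length (divisors n)) ℤ.* x
  where sumℤ = Data.List.foldr ℤ._+_ (+ 0)

WeaklyAlmostPrime : ℕ → Set
WeaklyAlmostPrime n = n ≥ 1 × (∀ (x : ℤ) → (+ n) ℤD.∣ T n x)

SquareFree : ℕ → Set
SquareFree n = ∀ (d : ℕ) → (d ℕ.* d) ℕD.∣ n → d ≡ 1

AlmostPrime : ℕ → Set
AlmostPrime n = WeaklyAlmostPrime n × SquareFree n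

-- Suppose a prime q divides n and φ(n). Since n is square-free, q ∣ p - 1 for a prime p ∣ n; write
-- p - 1 = e q and n = m q with q ∤ m. If y ≢ 1 were a q-th root of unity modulo p, summing
-- T_n(y^j) ≡ 0 (mod p) over j < q would isolate the divisors of n divisible by q and give p ∣ q τ(m),
-- impossible as τ(m) is a power of 2 and 2 < q < p. Hence x^e ≡ 1 (mod p) for x = 1, …, e + 1, since
-- (x^e)^q = x^(p-1) ≡ 1 by Fermat. The e-th finite difference of x^e - 1 is e!, so p ∣ e!, contradicting e < p.

module Submission where

open import Defs
open import Data.Nat using (ℕ)
open import Data.Nat.GCD using (gcd)
open import Relation.Binary.PropositionalEquality using (_≡_)

module Primes where

  open import Data.Nat using (zero; suc; _!; _≤_; _≟_; NonZero; ≢-nonZero)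
  open import Data.Nat.Properties using (m≤n⇒m≤1+n; <⇒≢)
  open import Data.Nat.Divisibility using (_∣_; ∣1⇒≡1; ∣⇒≤; ∣-refl; ∣-trans; ∣m⇒∣m*n; 0∣⇒≡0)
  open import Data.Nat.Coprimality using (Coprime)
  open import Data.Nat.Primality using (Prime; euclidsLemma; prime⇒irreducible)
  open import Data.Nat.Primality.Factorisation using (factorise)
  open import Data.Nat.ListAction using (product)
  open import Data.List using ([]; _∷_)
  open import Data.List.Relation.Unary.All using (_∷_)
  open import Data.Product using (∃-syntax; _×_; _,_)
  open import Data.Sum using (inj₁; inj₂)
  open import Data.Empty using (⊥-elim)
  open import Relation.Nullary using (¬_; yes; no)
  open import Relation.Binary.PropositionalEquality

  prime≢1 : ∀ {p} → Prime p → p ≢ 1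
  prime≢1 () refl

  ∤⇒coprime : ∀ {p m} → Prime p → ¬ p ∣ m → Coprime m p
  ∤⇒coprime p-prime p∤m (d∣m , d∣p) with prime⇒irreducible p-prime d∣p
  ... | inj₁ d≡1 = d≡1
  ... | inj₂ refl = ⊥-elim (p∤m d∣m)

  prime∣!⇒≤ : ∀ {p} → Prime p → ∀ k → p ∣ k ! → p ≤ k
  prime∣!⇒≤ p-prime zero p∣1 = ⊥-elim (prime≢1 p-prime (∣1⇒≡1 p∣1))
  prime∣!⇒≤ p-prime (suc k) p∣k! with euclidsLemma (suc k) (k !) p-prime p∣k!
  ... | inj₁ p∣k+1 = ∣⇒≤ p∣k+1
  ... | inj₂ p∣k!  = m≤n⇒m≤1+n (prime∣!⇒≤ p-prime k p∣k!)

  prime-factor : ∀ n → .{{NonZero n}} → n ≢ 1 → ∃[ p ] Prime p × p ∣ n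
  prime-factor n n≢1 with factorise n
  ... | record { factors = [] ; isFactorisation = n≡1 } = ⊥-elim (n≢1 n≡1)
  ... | record { factors = p ∷ ps ; isFactorisation = n≡p*ps ; factorsPrime = p-prime ∷ _ } =
    p , p-prime , subst (p ∣_) (sym n≡p*ps) (∣m⇒∣m*n (product ps) ∣-refl)

  ¬common-prime⇒coprime : ∀ {m n} → 1 ≤ m → (∀ {q} → Prime q → q ∣ m → ¬ q ∣ n) → Coprime m n
  ¬common-prime⇒coprime {m} 1≤m no-common-prime {d} (d∣m , d∣n) with d ≟ 1
  ... | yes d≡1 = d≡1
  ... | no  d≢1 with prime-factor d {{≢-nonZero λ d≡0 → <⇒≢ 1≤m (sym (0∣⇒≡0 (subst (_∣ m) d≡0 d∣m)))}} d≢1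
  ...   | q , q-prime , q∣d = ⊥-elim (no-common-prime q-prime (∣-trans q∣d d∣m) (∣-trans q∣d d∣n))

module Congruence where

  open import Data.Nat using (zero; suc)
  open import Data.Nat.Primality using (Prime; euclidsLemma)
  import Data.Nat.Divisibility as ℕ
  open import Data.Integer using (ℤ; +_; _+_; _*_; _-_; -_; _^_; 0ℤ)
  import Data.Integer.Properties as ℤ
  open import Data.Integer.Divisibility.Signed
    using (_∣_; divides; ∣m⇒∣-m; ∣m∣n⇒∣m+n; ∣m⇒∣m*n; ∣n⇒∣m*n; ∣⇒∣ᵤ; ∣ᵤ⇒∣)
  open import Data.Integer.Tactic.RingSolver using (solve-∀)
  open import Data.Sum using (_⊎_; inj₁; inj₂)
  open import Relation.Binary using (IsEquivalence; Setoid)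
  open import Relation.Binary.PropositionalEquality

  infix 4 _≡_mod_
  record _≡_mod_ (a b : ℤ) (n : ℕ) : Set where
    constructor mk≡mod
    field ∣difference : + n ∣ a - b
  open _≡_mod_ public

  module _ {n : ℕ} where

    ≡-mod-reflexive : ∀ {a b} → a ≡ b → a ≡ b mod n
    ≡-mod-reflexive {a} refl = mk≡mod (subst (+ n ∣_) (sym (ℤ.+-inverseʳ a)) (divides 0ℤ refl))

    ≡-mod-refl : ∀ {a} → a ≡ a mod n
    ≡-mod-refl = ≡-mod-reflexive refl

    ≡-mod-sym : ∀ {a b} → a ≡ b mod n → b ≡ a mod n
    ≡-mod-sym {a} {b} (mk≡mod n∣a-b) = mk≡mod (subst (+ n ∣_) (lemma a b) (∣m⇒∣-m n∣a-b))
      where lemma : ∀ a b → - (a - b) ≡ b - a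
            lemma = solve-∀

    ≡-mod-trans : ∀ {a b c} → a ≡ b mod n → b ≡ c mod n → a ≡ c mod n
    ≡-mod-trans {a} {b} {c} (mk≡mod n∣a-b) (mk≡mod n∣b-c) =
      mk≡mod (subst (+ n ∣_) (lemma a b c) (∣m∣n⇒∣m+n n∣a-b n∣b-c))
      where lemma : ∀ a b c → (a - b) + (b - c) ≡ a - c
            lemma = solve-∀

    ≡-mod-isEquivalence : IsEquivalence (λ a b → a ≡ b mod n)
    ≡-mod-isEquivalence = record { refl = ≡-mod-refl ; sym = ≡-mod-sym ; trans = ≡-mod-trans }

    +-cong-mod : ∀ {a b c d} → a ≡ b mod n → c ≡ d mod n → a + c ≡ b + d mod n
    +-cong-mod {a} {b} {c} {d} (mk≡mod n∣a-b) (mk≡mod n∣c-d) =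
      mk≡mod (subst (+ n ∣_) (lemma a b c d) (∣m∣n⇒∣m+n n∣a-b n∣c-d))
      where lemma : ∀ a b c d → (a - b) + (c - d) ≡ (a + c) - (b + d)
            lemma = solve-∀

    *-cong-mod : ∀ {a b c d} → a ≡ b mod n → c ≡ d mod n → a * c ≡ b * d mod n
    *-cong-mod {a} {b} {c} {d} (mk≡mod n∣a-b) (mk≡mod n∣c-d) =
      mk≡mod (subst (+ n ∣_) (lemma a b c d) (∣m∣n⇒∣m+n (∣m⇒∣m*n c n∣a-b) (∣n⇒∣m*n b n∣c-d)))
      where lemma : ∀ a b c d → (a - b) * c + b * (c - d) ≡ a * c - b * d
            lemma = solve-∀

    ^-cong-mod : ∀ {a b} k → a ≡ b mod n → a ^ k ≡ b ^ k mod n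
    ^-cong-mod zero    a≡b = ≡-mod-refl
    ^-cong-mod (suc k) a≡b = *-cong-mod a≡b (^-cong-mod k a≡b)

    ∣⇒≡0-mod : ∀ {a} → + n ∣ a → a ≡ 0ℤ mod n
    ∣⇒≡0-mod {a} n∣a = mk≡mod (subst (+ n ∣_) (sym (ℤ.+-identityʳ a)) n∣a)

    ≡0-mod⇒∣ : ∀ {a} → a ≡ 0ℤ mod n → + n ∣ a
    ≡0-mod⇒∣ {a} (mk≡mod n∣a-0) = subst (+ n ∣_) (ℤ.+-identityʳ a) n∣a-0

  ≡-mod-setoid : ℕ → Setoid _ _
  ≡-mod-setoid n = record { isEquivalence = ≡-mod-isEquivalence {n} }

  euclidsLemmaℤ : ∀ a b {p} → Prime p → + p ∣ a * b → (+ p ∣ a) ⊎ (+ p ∣ b)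
  euclidsLemmaℤ a b {p} p-prime p∣ab with euclidsLemma _ _ p-prime (subst (p ℕ.∣_) (ℤ.abs-* a b) (∣⇒∣ᵤ p∣ab))
  ... | inj₁ p∣a = inj₁ (∣ᵤ⇒∣ p∣a)
  ... | inj₂ p∣b = inj₂ (∣ᵤ⇒∣ p∣b)

module Fermat where

  open Primes
  open Congruence
  open import Data.Nat using (zero; suc; _!; _∸_; _<_; _≤_; s≤s; z≤n)
    renaming (_*_ to _*ℕ_)
  open import Data.Nat.Properties using (<⇒≤; <⇒≱; ∸-monoʳ-<; n∸n≡0; m*n≢0; _!≢0; *-comm)
  import Data.Nat.Divisibility as ℕ
  open import Data.Nat.DivMod using (m/n*n≡m)
  open import Data.Nat.Combinatorics using (_C_; nCk≡n!/k![n-k]!; k![n∸k]!∣n!; nCn≡1)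
  open import Data.Nat.Primality using (Prime; euclidsLemma)
  open import Data.Integer using (ℤ; +_; _+_; _*_; _-_; _^_; 0ℤ; 1ℤ)
  import Data.Integer.Properties as ℤ
  open import Data.Integer.Divisibility.Signed using (_∣_; divides; ∣m∣n⇒∣m+n; ∣m⇒∣m*n; ∣⇒∣ᵤ; ∣ᵤ⇒∣)
  open import Data.Integer.Tactic.RingSolver using (solve-∀)
  open import Data.Fin as Fin using (toℕ; fromℕ; inject₁)
  open import Data.Fin.Properties using (toℕ-fromℕ; toℕ-inject₁; toℕ<n)
  open import Data.Vec.Functional using (Vector; init; tail)
  open import Algebra.Properties.Semiring.Sum ℤ.+-*-semiring using (sum; sum-init-last)
  open import Algebra.Properties.Semiring.Mult ℤ.+-*-semiring using (_×_)
  open import Algebra.Properties.Semiring.Exp ℤ.+-*-semiring using () renaming (_^_ to _^′_)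
  import Algebra.Properties.CommutativeSemiring.Binomial ℤ.+-*-commutativeSemiring as Binomial
  open import Data.Sum using (inj₁; inj₂; [_,_]′)
  open import Data.Empty using (⊥-elim)
  open import Function using (_∘_)
  open import Relation.Nullary using (¬_)
  open import Relation.Binary.PropositionalEquality

  nCk*k![n∸k]!≡n! : ∀ {n k} → k ≤ n → (n C k) *ℕ (k ! *ℕ (n ∸ k) !) ≡ n !
  nCk*k![n∸k]!≡n! {n} {k} k≤n =
    trans (cong (_*ℕ (k ! *ℕ (n ∸ k) !)) (nCk≡n!/k![n-k]! k≤n)) (m/n*n≡m (k![n∸k]!∣n! k≤n))
    where instance _ = m*n≢0 (k !) ((n ∸ k) !) {{k !≢0}} {{(n ∸ k) !≢0}}

  prime∣pCk : ∀ {p k} → Prime p → 0 < k → k < p → p ℕ.∣ p C k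
  prime∣pCk {p@(suc p-1)} {k} p-prime 0<k k<p
    with euclidsLemma (p C k) (k ! *ℕ (p ∸ k) !) p-prime
           (ℕ.divides (p-1 !) (trans (nCk*k![n∸k]!≡n! (<⇒≤ k<p)) (*-comm p (p-1 !))))
  ... | inj₁ p∣pCk = p∣pCk
  ... | inj₂ p∣k![p∸k]! with euclidsLemma (k !) ((p ∸ k) !) p-prime p∣k![p∸k]!
  ...   | inj₁ p∣k!     = ⊥-elim (<⇒≱ k<p (prime∣!⇒≤ p-prime k p∣k!))
  ...   | inj₂ p∣[p∸k]! = ⊥-elim (<⇒≱ (∸-monoʳ-< 0<k (<⇒≤ k<p)) (prime∣!⇒≤ p-prime (p ∸ k) p∣[p∸k]!))

  ×≡* : ∀ k z → k × z ≡ + k * z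
  ×≡* zero    z = sym (ℤ.*-zeroˡ z)
  ×≡* (suc k) z = trans (cong (λ w → z + w) (×≡* k z)) (sym (ℤ.suc-* (+ k) z))

  -- The binomial theorem is stated for the semiring power _^′_, which is not definitionally _^_.
  ^′≡^ : ∀ z k → z ^′ k ≡ z ^ k
  ^′≡^ z zero    = refl
  ^′≡^ z (suc k) = cong (z *_) (^′≡^ z k)

  ∣-sum : ∀ {d k} (f : Vector ℤ k) → (∀ i → d ∣ f i) → d ∣ sum f
  ∣-sum {k = zero}  f d∣f = divides 0ℤ refl
  ∣-sum {k = suc k} f d∣f = ∣m∣n⇒∣m+n (d∣f Fin.zero) (∣-sum (tail f) (d∣f ∘ Fin.suc))

  -- In the binomial expansion of (1 + z)^p all terms but the first and last are divisible by p.
  [1+z]^p≡1+z^p : ∀ {p} → Prime p → ∀ z → (1ℤ + z) ^ p ≡ 1ℤ + z ^ p mod p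
  [1+z]^p≡1+z^p {p@(suc m)} p-prime z = mk≡mod (subst (+ p ∣_) middle≡ (∣-sum middle p∣middle))
    where
      open Binomial using (theorem; binomial; binomialTerm)
      term : Vector ℤ (suc p)
      term = binomialTerm 1ℤ z p
      middle : Vector ℤ m
      middle = init (tail term)

      p∣middle : ∀ i → + p ∣ middle i
      p∣middle i = subst (+ p ∣_) (sym (×≡* (p C k) b))
                     (∣m⇒∣m*n b (∣ᵤ⇒∣ {+ p} {+ (p C k)} (prime∣pCk p-prime (s≤s z≤n) (s≤s k-1<m))))
        where
          k : ℕ
          k = suc (toℕ (inject₁ i))
          b : ℤ
          b = binomial 1ℤ z p (Fin.suc (inject₁ i))
          k-1<m : toℕ (inject₁ i) < m
          k-1<m = subst (_< m) (sym (toℕ-inject₁ i)) (toℕ<n i)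

      first : term Fin.zero ≡ z ^ p
      first = trans (ℤ.+-identityʳ _) (trans (ℤ.*-identityˡ _) (^′≡^ z p))

      last : term (fromℕ p) ≡ 1ℤ
      last = begin
        term (fromℕ p)                      ≡⟨ cong (λ k → (p C k) × (1ℤ ^′ k * z ^′ (p ∸ k))) (toℕ-fromℕ p) ⟩
        (p C p) × (1ℤ ^′ p * z ^′ (p ∸ p))  ≡⟨ cong₂ (λ c e → c × (1ℤ ^′ p * z ^′ e)) (nCn≡1 p) (n∸n≡0 p) ⟩
        1 × (1ℤ ^′ p * 1ℤ)                  ≡⟨ trans (ℤ.+-identityʳ _) (trans (ℤ.*-identityʳ _) (^′≡^ 1ℤ p)) ⟩
        1ℤ ^ p                              ≡⟨ ℤ.^-zeroˡ p ⟩
        1ℤ                                  ∎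
        where open ≡-Reasoning

      expansion : (1ℤ + z) ^ p ≡ z ^ p + (sum middle + 1ℤ)
      expansion = trans (sym (^′≡^ (1ℤ + z) p)) (trans (theorem p 1ℤ z)
        (cong₂ _+_ first (trans (sum-init-last (tail term)) (cong (λ w → sum middle + w) last))))

      middle≡ : sum middle ≡ (1ℤ + z) ^ p - (1ℤ + z ^ p)
      middle≡ rewrite expansion = lemma (z ^ p) (sum middle)
        where lemma : ∀ a c → c ≡ (a + (c + 1ℤ)) - (1ℤ + a)
              lemma = solve-∀

  x^p≡x : ∀ {p} → Prime p → ∀ x → (+ x) ^ p ≡ + x mod p
  x^p≡x {suc _} p-prime zero    = ≡-mod-refl
  x^p≡x         p-prime (suc x) = ≡-mod-trans ([1+z]^p≡1+z^p p-prime (+ x)) (+-cong-mod (≡-mod-refl {a = 1ℤ}) (x^p≡x p-prime x))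

  x^[p∸1]≡1 : ∀ {p} → Prime p → ∀ {x} → ¬ p ℕ.∣ x → (+ x) ^ (p ∸ 1) ≡ 1ℤ mod p
  x^[p∸1]≡1 {p@(suc m)} p-prime {x} p∤x =
    [ (λ p∣x → ⊥-elim (p∤x (∣⇒∣ᵤ p∣x))) , mk≡mod ]′ (euclidsLemmaℤ (+ x) ((+ x) ^ m - 1ℤ) p-prime p∣x[x^m-1])
    where
      p∣x[x^m-1] : + p ∣ + x * ((+ x) ^ m - 1ℤ)
      p∣x[x^m-1] = subst (+ p ∣_) (lemma (+ x) ((+ x) ^ m)) (∣difference (x^p≡x p-prime x))
        where lemma : ∀ a b → a * b - a ≡ a * (b - 1ℤ)
              lemma = solve-∀

module FiniteDifferences where

  open Primes using (prime∣!⇒≤)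
  open import Data.Nat using (zero; suc; _!; _≤_; _<_; s≤s; z≤n)
  open import Data.Nat.Properties using (m≤n⇒m≤1+n; <⇒≱)
  open import Data.Nat.Primality using (Prime)
  open import Data.Integer using (ℤ; +_; _+_; _*_; _-_; _^_; 0ℤ; 1ℤ)
  import Data.Integer.Properties as ℤ
  open import Data.Integer.Divisibility.Signed using (_∣_; ∣m∣n⇒∣m-n; ∣⇒∣ᵤ)
  open import Data.Integer.Tactic.RingSolver using (solve-∀)
  open import Data.Product using (∃; _×_; _,_)
  open import Relation.Nullary using (¬_)
  open import Relation.Binary.PropositionalEquality

  Δ : (ℤ → ℤ) → ℤ → ℤ
  Δ f x = f (x + 1ℤ) - f x

  Δ^ : ℕ → (ℤ → ℤ) → ℤ → ℤ
  Δ^ zero    f = f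
  Δ^ (suc d) f = Δ^ d (Δ f)

  DegreeBelow : ℕ → (ℤ → ℤ) → Set
  DegreeBelow zero    f = ∀ x → f x ≡ 0ℤ
  DegreeBelow (suc d) f = DegreeBelow d (Δ f)

  DegreeBelow-cong : ∀ d {f g} → f ≗ g → DegreeBelow d f → DegreeBelow d g
  DegreeBelow-cong zero    f≗g f≡0 x = trans (sym (f≗g x)) (f≡0 x)
  DegreeBelow-cong (suc d) f≗g       = DegreeBelow-cong d (λ x → cong₂ _-_ (f≗g (x + 1ℤ)) (f≗g x))

  DegreeBelow-+ : ∀ d {f g} → DegreeBelow d f → DegreeBelow d g → DegreeBelow d (λ x → f x + g x)
  DegreeBelow-+ zero    f≡0 g≡0 x = cong₂ _+_ (f≡0 x) (g≡0 x)
  DegreeBelow-+ (suc d) {f} {g} Δf Δg =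
    DegreeBelow-cong d (λ x → lemma (f (x + 1ℤ)) (g (x + 1ℤ)) (f x) (g x)) (DegreeBelow-+ d Δf Δg)
    where lemma : ∀ a b c d → (a - c) + (b - d) ≡ (a + b) - (c + d)
          lemma = solve-∀

  DegreeBelow-*ˡ : ∀ d c {f} → DegreeBelow d f → DegreeBelow d (λ x → c * f x)
  DegreeBelow-*ˡ zero    c f≡0 x = trans (cong (c *_) (f≡0 x)) (ℤ.*-zeroʳ c)
  DegreeBelow-*ˡ (suc d) c {f} Δf = DegreeBelow-cong d (λ x → lemma c (f (x + 1ℤ)) (f x)) (DegreeBelow-*ˡ d c Δf)
    where lemma : ∀ c a b → c * (a - b) ≡ c * a - c * b
          lemma = solve-∀

  DegreeBelow-suc : ∀ d {f} → DegreeBelow d f → DegreeBelow (suc d) f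
  DegreeBelow-suc zero    {f} f≡0 x = cong₂ (λ a b → a - b) (f≡0 (x + 1ℤ)) (f≡0 x)
  DegreeBelow-suc (suc d) Δf    = DegreeBelow-suc d Δf

  DegreeBelow-shift : ∀ d {f} → DegreeBelow d f → DegreeBelow d (λ x → f (x + 1ℤ))
  DegreeBelow-shift zero    f≡0 x = f≡0 (x + 1ℤ)
  DegreeBelow-shift (suc d) Δf    = DegreeBelow-shift d Δf

  DegreeBelow-const : ∀ d c → DegreeBelow (suc d) (λ _ → c)
  DegreeBelow-const zero    c x = ℤ.+-inverseʳ c
  DegreeBelow-const (suc d) c   = DegreeBelow-suc (suc d) {λ _ → c} (DegreeBelow-const d c)

  DegreeBelow-x* : ∀ d {h} → DegreeBelow d h → DegreeBelow (suc d) (λ x → x * h x)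
  DegreeBelow-x* zero    {h} h≡0 x =
    trans (cong₂ (λ u v → (x + 1ℤ) * u - x * v) (h≡0 (x + 1ℤ)) (h≡0 x)) (lemma x)
    where lemma : ∀ x → (x + 1ℤ) * 0ℤ - x * 0ℤ ≡ 0ℤ
          lemma = solve-∀
  DegreeBelow-x* (suc d) {h} Δh = DegreeBelow-cong (suc d) (λ x → lemma x (h (x + 1ℤ)) (h x))
    (DegreeBelow-+ (suc d) {λ x → x * Δ h x} {λ x → h (x + 1ℤ)} (DegreeBelow-x* d Δh) (DegreeBelow-shift (suc d) {h} Δh))
    where lemma : ∀ x a b → x * (a - b) + a ≡ (x + 1ℤ) * a - x * b
          lemma = solve-∀

  DegreeBelow-^ : ∀ k → DegreeBelow (suc k) (_^ k)
  DegreeBelow-^ zero    = DegreeBelow-const zero 1ℤ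
  DegreeBelow-^ (suc k) = DegreeBelow-x* (suc k) {_^ k} (DegreeBelow-^ k)

  Δ-^ : ∀ k → ∃ λ h → DegreeBelow k h × (∀ x → Δ (_^ suc k) x ≡ + suc k * x ^ k + h x)
  Δ-^ zero = (λ _ → 0ℤ) , (λ _ → refl) , λ x → lemma x
    where lemma : ∀ x → (x + 1ℤ) * 1ℤ - x * 1ℤ ≡ 1ℤ * 1ℤ + 0ℤ
          lemma = solve-∀
  Δ-^ (suc k) with Δ-^ k
  ... | h , h<k , Δx^k+1 = h′ , h′<k+1 , Δx^k+2
    where
      h′ : ℤ → ℤ
      h′ x = + suc k * x ^ k + x * h x + h x

      h′<k+1 : DegreeBelow (suc k) h′
      h′<k+1 = DegreeBelow-+ (suc k) {λ x → + suc k * x ^ k + x * h x} {h}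
        (DegreeBelow-+ (suc k) {λ x → + suc k * x ^ k}
          (DegreeBelow-*ˡ (suc k) (+ suc k) {_^ k} (DegreeBelow-^ k)) (DegreeBelow-x* k h<k))
        (DegreeBelow-suc k h<k)

      Δx^k+2 : ∀ x → Δ (_^ suc (suc k)) x ≡ + suc (suc k) * x ^ suc k + h′ x
      Δx^k+2 x = begin
        (x + 1ℤ) * (x + 1ℤ) ^ suc k - x * x ^ suc k
          ≡⟨ cong (λ y → (x + 1ℤ) * y - x * x ^ suc k) (x+1^k+1 x) ⟩
        (x + 1ℤ) * (x ^ suc k + (+ suc k * x ^ k + h x)) - x * x ^ suc k
          ≡⟨ lemma x (x ^ k) (+ suc k) (h x) ⟩
        (1ℤ + + suc k) * x ^ suc k + h′ x
          ≡⟨ cong (λ c → c * x ^ suc k + h′ x) (sym (ℤ.pos-+ 1 (suc k))) ⟩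
        + suc (suc k) * x ^ suc k + h′ x ∎
        where
          open ≡-Reasoning
          x+1^k+1 : ∀ x → (x + 1ℤ) ^ suc k ≡ x ^ suc k + (+ suc k * x ^ k + h x)
          x+1^k+1 x = trans (sym (lemma′ ((x + 1ℤ) ^ suc k) (x ^ suc k))) (cong (λ y → x ^ suc k + y) (Δx^k+1 x))
            where lemma′ : ∀ a b → b + (a - b) ≡ a
                  lemma′ = solve-∀
          lemma : ∀ x y c z → (x + 1ℤ) * (x * y + (c * y + z)) - x * (x * y) ≡ (1ℤ + c) * (x * y) + (c * y + x * z + z)
          lemma = solve-∀

  Δ^-leading : ∀ d c {f h} → DegreeBelow d h → (∀ x → f x ≡ c * x ^ d + h x) → ∀ x → Δ^ d f x ≡ + (d !) * c
  Δ^-leading zero c {f} {h} h≡0 f≡ x = trans (f≡ x) (trans (cong (λ y → c * 1ℤ + y) (h≡0 x)) (lemma c))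
    where lemma : ∀ c → c * 1ℤ + 0ℤ ≡ 1ℤ * c
          lemma = solve-∀
  Δ^-leading (suc d) c {f} {h} h<d+1 f≡ with Δ-^ d
  ... | g , g<d , Δx^d+1 = λ x → trans (Δ^-leading d (c * + suc d) {Δ f} {λ x → c * g x + Δ h x}
          (DegreeBelow-+ d {λ x → c * g x} (DegreeBelow-*ˡ d c g<d) h<d+1) Δf≡ x) d!*[c*d+1]≡[d+1]!*c
    where
      Δf≡ : ∀ x → Δ f x ≡ c * + suc d * x ^ d + (c * g x + Δ h x)
      Δf≡ x = begin
        f (x + 1ℤ) - f x
          ≡⟨ cong₂ _-_ (f≡ (x + 1ℤ)) (f≡ x) ⟩
        (c * (x + 1ℤ) ^ suc d + h (x + 1ℤ)) - (c * x ^ suc d + h x)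
          ≡⟨ lemma₁ c ((x + 1ℤ) ^ suc d) (x ^ suc d) (h (x + 1ℤ)) (h x) ⟩
        c * Δ (_^ suc d) x + Δ h x
          ≡⟨ cong (λ y → c * y + Δ h x) (Δx^d+1 x) ⟩
        c * (+ suc d * x ^ d + g x) + Δ h x
          ≡⟨ lemma₂ c (+ suc d) (x ^ d) (g x) (Δ h x) ⟩
        c * + suc d * x ^ d + (c * g x + Δ h x) ∎
        where
          open ≡-Reasoning
          lemma₁ : ∀ c a b u v → (c * a + u) - (c * b + v) ≡ c * (a - b) + (u - v)
          lemma₁ = solve-∀
          lemma₂ : ∀ c s y u v → c * (s * y + u) + v ≡ c * s * y + (c * u + v)
          lemma₂ = solve-∀
      d!*[c*d+1]≡[d+1]!*c : + (d !) * (c * + suc d) ≡ + (suc d !) * c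
      d!*[c*d+1]≡[d+1]!*c = trans (lemma (+ (d !)) c (+ suc d)) (cong (_* c) (sym (ℤ.pos-* (suc d) (d !))))
        where lemma : ∀ a c s → a * (c * s) ≡ s * a * c
              lemma = solve-∀

  ∣-Δ^ : ∀ {n} d f a → (∀ i → i ≤ d → + n ∣ f (a + + i)) → + n ∣ Δ^ d f a
  ∣-Δ^ zero    f a n∣f = subst (λ x → _ ∣ f x) (ℤ.+-identityʳ a) (n∣f 0 z≤n)
  ∣-Δ^ (suc d) f a n∣f = ∣-Δ^ d (Δ f) a λ i i≤d →
    ∣m∣n⇒∣m-n (subst (λ x → _ ∣ f x) (a+i+1≡a+[1+i] i) (n∣f (suc i) (s≤s i≤d))) (n∣f i (m≤n⇒m≤1+n i≤d))
    where a+i+1≡a+[1+i] : ∀ i → a + + suc i ≡ a + + i + 1ℤ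
          a+i+1≡a+[1+i] i = trans (cong (λ y → a + y) (trans (ℤ.pos-+ 1 i) (ℤ.+-comm 1ℤ (+ i))))
                                  (sym (ℤ.+-assoc a (+ i) 1ℤ))

  -- Its d-th difference at a is d!, an integer combination of the values at a, …, a + d, and p ∤ d!.
  monic-no-consecutive-roots : ∀ {p d h} → Prime p → d < p → DegreeBelow d h → ∀ a →
                               ¬ (∀ i → i ≤ d → + p ∣ (a + + i) ^ d + h (a + + i))
  monic-no-consecutive-roots {p} {d} {h} pr d<p h<d a p∣f =
    <⇒≱ d<p (prime∣!⇒≤ pr d (∣⇒∣ᵤ p∣d!))
    where
      p∣d! : + p ∣ + (d !)
      p∣d! = subst (+ p ∣_) Δ^d[f]≡d! (∣-Δ^ d (λ x → x ^ d + h x) a p∣f)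
        where Δ^d[f]≡d! : Δ^ d (λ x → x ^ d + h x) a ≡ + (d !)
              Δ^d[f]≡d! = trans (Δ^-leading d 1ℤ h<d (λ x → cong (λ y → y + h x) (sym (ℤ.*-identityˡ (x ^ d)))) a)
                                (ℤ.*-identityʳ _)

module RootsOfUnity where

  open Primes using (∤⇒coprime)
  open Congruence
  open import Data.Nat using (zero; suc)
  import Data.Nat as ℕ
  import Data.Nat.Properties as ℕ
  import Data.Nat.Divisibility as ℕ
  open import Data.Nat.Divisibility using (_∣?_)
  open import Data.Nat.Coprimality using (Coprime; coprime-Bézout)
  open import Data.Nat.GCD using (module Bézout)
  open import Data.Nat.Primality using (Prime)
  open import Data.Integer using (ℤ; +_; _+_; _*_; _-_; _^_; 0ℤ; 1ℤ)
  import Data.Integer.Properties as ℤ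
  open import Data.Integer.Divisibility.Signed using (_∣_)
  open import Data.Integer.Tactic.RingSolver using (solve-∀)
  open import Data.Fin as Fin using (toℕ)
  open import Data.Vec.Functional using (Vector)
  open import Algebra.Properties.Semiring.Sum ℤ.+-*-semiring
    using (sum; sum-syntax; ∑-distrib-+; *-distribˡ-sum; sum-replicate-zero; sum-cong-≗)
  open import Data.List using (List; []; _∷_; foldr; map; filter; length)
  open import Data.Sum using (inj₁; inj₂)
  open import Data.Empty using (⊥-elim)
  open import Relation.Nullary using (¬_; yes; no)
  open import Relation.Binary.PropositionalEquality
  import Relation.Binary.Reasoning.Setoid as SetoidReasoning

  geometric : ℤ → ℕ → ℤ
  geometric z k = ∑[ j < k ] (z ^ toℕ j)

  geometric-suc : ∀ z k → geometric z (suc k) ≡ 1ℤ + z * geometric z k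
  geometric-suc z k = cong (λ s → 1ℤ + s) (sym (*-distribˡ-sum {k} z (λ j → z ^ toℕ j)))

  geometric-closed : ∀ z k → (z - 1ℤ) * geometric z k ≡ z ^ k - 1ℤ
  geometric-closed z zero    = ℤ.*-zeroʳ (z - 1ℤ)
  geometric-closed z (suc k) = begin
    (z - 1ℤ) * geometric z (suc k)      ≡⟨ cong ((z - 1ℤ) *_) (geometric-suc z k) ⟩
    (z - 1ℤ) * (1ℤ + z * geometric z k) ≡⟨ lemma z (geometric z k) ⟩
    z - 1ℤ + z * ((z - 1ℤ) * geometric z k) ≡⟨ cong (λ s → z - 1ℤ + z * s) (geometric-closed z k) ⟩
    z - 1ℤ + z * (z ^ k - 1ℤ)           ≡⟨ lemma′ z (z ^ k) ⟩
    z ^ suc k - 1ℤ                      ∎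
    where
      open ≡-Reasoning
      lemma : ∀ z g → (z - 1ℤ) * (1ℤ + z * g) ≡ z - 1ℤ + z * ((z - 1ℤ) * g)
      lemma = solve-∀
      lemma′ : ∀ z w → z - 1ℤ + z * (w - 1ℤ) ≡ z * w - 1ℤ
      lemma′ = solve-∀

  module _ {n : ℕ} where

    ^-≡1 : ∀ {z} k → z ≡ 1ℤ mod n → z ^ k ≡ 1ℤ mod n
    ^-≡1 {z} k z≡1 = ≡-mod-trans (^-cong-mod k z≡1) (≡-mod-reflexive (ℤ.^-zeroˡ k))

    ^-*-≡1 : ∀ {z} a c → z ^ a ≡ 1ℤ mod n → z ^ (c ℕ.* a) ≡ 1ℤ mod n
    ^-*-≡1 {z} a c z^a≡1 =
      ≡-mod-trans (≡-mod-reflexive (trans (cong (z ^_) (ℕ.*-comm c a)) (sym (ℤ.^-*-assoc z a c)))) (^-≡1 c z^a≡1)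

    geometric-≡1 : ∀ {z} k → z ≡ 1ℤ mod n → geometric z k ≡ + k mod n
    geometric-≡1 zero    z≡1 = ≡-mod-refl
    geometric-≡1 {z} (suc k) z≡1 = begin
      geometric z (suc k)       ≡⟨ geometric-suc z k ⟩
      1ℤ + z * geometric z k    ≈⟨ +-cong-mod (≡-mod-refl {a = 1ℤ}) (*-cong-mod z≡1 (geometric-≡1 k z≡1)) ⟩
      1ℤ + 1ℤ * + k             ≡⟨ cong (λ s → 1ℤ + s) (ℤ.*-identityˡ (+ k)) ⟩
      + suc k                   ∎
      where open SetoidReasoning (≡-mod-setoid n)

    ≡1-from-Bézout : ∀ {z} u v s t → z ^ u ≡ 1ℤ mod n → z ^ v ≡ 1ℤ mod n →
                     1 ℕ.+ t ℕ.* u ≡ s ℕ.* v → z ≡ 1ℤ mod n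
    ≡1-from-Bézout {z} u v s t z^u≡1 z^v≡1 1+tu≡sv = begin
      z                ≡⟨ sym (ℤ.*-identityʳ z) ⟩
      z * 1ℤ           ≈⟨ *-cong-mod (≡-mod-refl {a = z}) (≡-mod-sym (^-*-≡1 u t z^u≡1)) ⟩
      z ^ suc (t ℕ.* u) ≡⟨ cong (z ^_) 1+tu≡sv ⟩
      z ^ (s ℕ.* v)    ≈⟨ ^-*-≡1 v s z^v≡1 ⟩
      1ℤ               ∎
      where open SetoidReasoning (≡-mod-setoid n)

    ≡1-coprime-exponents : ∀ {z a b} → Coprime a b → z ^ a ≡ 1ℤ mod n → z ^ b ≡ 1ℤ mod n → z ≡ 1ℤ mod n
    ≡1-coprime-exponents {a = a} {b} a⊥b z^a≡1 z^b≡1 with coprime-Bézout a⊥b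
    ... | Bézout.+- s t 1+tb≡sa = ≡1-from-Bézout b a s t z^b≡1 z^a≡1 1+tb≡sa
    ... | Bézout.-+ s t 1+sa≡tb = ≡1-from-Bézout a b t s z^a≡1 z^b≡1 1+sa≡tb

  geometric-root : ∀ {p} → Prime p → ∀ {z} k → z ^ k ≡ 1ℤ mod p → ¬ z ≡ 1ℤ mod p → geometric z k ≡ 0ℤ mod p
  geometric-root {p} pr {z} k z^k≡1 z≢1
    with euclidsLemmaℤ (z - 1ℤ) (geometric z k) pr (subst (+ p ∣_) (sym (geometric-closed z k)) (∣difference z^k≡1))
  ... | inj₁ p∣z-1 = ⊥-elim (z≢1 (mk≡mod p∣z-1))
  ... | inj₂ p∣sum = ∣⇒≡0-mod p∣sum

  sum-cong-mod : ∀ {n k} {f g : Vector ℤ k} → (∀ i → f i ≡ g i mod n) → sum f ≡ sum g mod n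
  sum-cong-mod {k = zero}  f≡g = ≡-mod-refl
  sum-cong-mod {k = suc k} f≡g = +-cong-mod (f≡g Fin.zero) (sum-cong-mod (λ i → f≡g (Fin.suc i)))

  ^-comm : ∀ z a b → (z ^ a) ^ b ≡ (z ^ b) ^ a
  ^-comm z a b = trans (ℤ.^-*-assoc z a b) (trans (cong (z ^_) (ℕ.*-comm a b)) (sym (ℤ.^-*-assoc z b a)))

  powerSum : List ℕ → ℤ → ℤ
  powerSum ds x = foldr _+_ 0ℤ (map (λ d → x ^ d) ds)

  ∑-powerSum : ∀ ds z k → ∑[ j < k ] powerSum ds (z ^ toℕ j) ≡ foldr _+_ 0ℤ (map (λ d → geometric (z ^ d) k) ds)
  ∑-powerSum []       z k = sum-replicate-zero k
  ∑-powerSum (d ∷ ds) z k = begin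
    ∑[ j < k ] ((z ^ toℕ j) ^ d + powerSum ds (z ^ toℕ j))
      ≡⟨ ∑-distrib-+ {k} (λ j → (z ^ toℕ j) ^ d) (λ j → powerSum ds (z ^ toℕ j)) ⟩
    ∑[ j < k ] ((z ^ toℕ j) ^ d) + ∑[ j < k ] powerSum ds (z ^ toℕ j)
      ≡⟨ cong₂ _+_ (sum-cong-≗ {k} (λ j → ^-comm z (toℕ j) d)) (∑-powerSum ds z k) ⟩
    geometric (z ^ d) k + foldr _+_ 0ℤ (map (λ d → geometric (z ^ d) k) ds) ∎
    where open ≡-Reasoning

  module PrimeOrderRoot {p q : ℕ} (p-prime : Prime p) (q-prime : Prime q)
                        {y : ℤ} (y^q≡1 : y ^ q ≡ 1ℤ mod p) (y≢1 : ¬ y ≡ 1ℤ mod p) where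

    open SetoidReasoning (≡-mod-setoid p)

    y^d≢1 : ∀ d → ¬ q ℕ.∣ d → ¬ y ^ d ≡ 1ℤ mod p
    y^d≢1 d q∤d y^d≡1 = y≢1 (≡1-coprime-exponents (∤⇒coprime q-prime q∤d) y^d≡1 y^q≡1)

    ∑-geometric-powers : ∀ ds → foldr _+_ 0ℤ (map (λ d → geometric (y ^ d) q) ds) ≡ + q * + length (filter (q ∣?_) ds) mod p
    ∑-geometric-powers [] = ≡-mod-reflexive (sym (ℤ.*-zeroʳ (+ q)))
    ∑-geometric-powers (d ∷ ds) with q ∣? d
    ... | yes (ℕ.divides k refl) = begin
      geometric (y ^ (k ℕ.* q)) q + rest   ≈⟨ +-cong-mod (geometric-≡1 q (^-*-≡1 q k y^q≡1)) (∑-geometric-powers ds) ⟩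
      + q + + q * + c                      ≡⟨ lemma (+ q) (+ c) ⟩
      + q * + suc c                        ∎
      where
        rest : ℤ
        rest = foldr _+_ 0ℤ (map (λ d → geometric (y ^ d) q) ds)
        c : ℕ
        c = length (filter (q ∣?_) ds)
        lemma : ∀ a b → a + a * b ≡ a * (1ℤ + b)
        lemma = solve-∀
    ... | no q∤d = begin
      geometric (y ^ d) q + rest   ≈⟨ +-cong-mod (geometric-root p-prime q y^dq≡1 (y^d≢1 d q∤d)) (∑-geometric-powers ds) ⟩
      0ℤ + + q * + c               ≡⟨ ℤ.+-identityˡ _ ⟩
      + q * + c                    ∎
      where
        rest : ℤ
        rest = foldr _+_ 0ℤ (map (λ d → geometric (y ^ d) q) ds)
        c : ℕ
        c = length (filter (q ∣?_) ds)
        y^dq≡1 : (y ^ d) ^ q ≡ 1ℤ mod p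
        y^dq≡1 = ≡-mod-trans (≡-mod-reflexive (^-comm y d q)) (^-≡1 d y^q≡1)

    -- Σ_{j<q} (y^d)^j is q if q ∣ d and 0 otherwise; sum the hypothesis over j < q.
    roots-of-unity-filter : ∀ ds → (∀ j → powerSum ds (y ^ j) ≡ + length ds * y ^ j mod p) →
                    + q * + length (filter (q ∣?_) ds) ≡ 0ℤ mod p
    roots-of-unity-filter ds powerSum≡ = begin
      + q * + length (filter (q ∣?_) ds)                    ≈⟨ ≡-mod-sym (∑-geometric-powers ds) ⟩
      foldr _+_ 0ℤ (map (λ d → geometric (y ^ d) q) ds)     ≡⟨ sym (∑-powerSum ds y q) ⟩
      ∑[ j < q ] powerSum ds (y ^ toℕ j)                    ≈⟨ sum-cong-mod {k = q} (λ j → powerSum≡ (toℕ j)) ⟩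
      ∑[ j < q ] (+ length ds * y ^ toℕ j)                  ≡⟨ sym (*-distribˡ-sum {q} (+ length ds) (λ j → y ^ toℕ j)) ⟩
      + length ds * geometric y q                           ≈⟨ *-cong-mod (≡-mod-refl {a = + length ds}) (geometric-root p-prime q y^q≡1 y≢1) ⟩
      + length ds * 0ℤ                                      ≡⟨ ℤ.*-zeroʳ (+ length ds) ⟩
      0ℤ                                                    ∎

module Counting where

  open import Data.Nat using (zero; suc; _+_; _*_; _<_; s≤s; z≤n)
  open import Data.Nat.Properties
  open import Data.Nat.Divisibility using (_∣_; _∣?_; ∣m+n∣m⇒∣n; ∣m∣n⇒∣m+n; ∣-refl; ∣⇒≤)
  open import Data.Bool using (if_then_else_)
  open import Data.List using (filter; length; applyUpTo)
  open import Data.Product using (_×_; _,_; proj₁)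
  open import Function using (_∘_)
  open import Relation.Binary.PropositionalEquality
  open import Relation.Nullary using (¬_; does; yes; no)
  open import Relation.Unary using (Pred; Decidable)
  open import Relation.Unary.Properties using (_∩?_; ∁?)
  open import Data.Empty using (⊥-elim)
  open import Level using (Level)
  open import Function.Bundles using (_⇔_; mk⇔; Equivalence)

  private
    variable
      ℓ ℓ′ : Level

  count : {P : Pred ℕ ℓ} → Decidable P → ℕ → ℕ
  count P? zero    = 0
  count P? (suc n) = if does (P? 0) then suc (count (P? ∘ suc) n) else count (P? ∘ suc) n

  length-filter-applyUpTo : ∀ {P : Pred ℕ ℓ} (P? : Decidable P) f n → length (filter P? (applyUpTo f n)) ≡ count (P? ∘ f) n
  length-filter-applyUpTo P? f zero = refl
  length-filter-applyUpTo P? f (suc n) with P? (f 0)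
  ... | yes _ = cong suc (length-filter-applyUpTo P? (f ∘ suc) n)
  ... | no  _ = length-filter-applyUpTo P? (f ∘ suc) n

  length-filter-filter-applyUpTo : ∀ {P : Pred ℕ ℓ} {Q : Pred ℕ ℓ′} (P? : Decidable P) (Q? : Decidable Q) f n →
    length (filter Q? (filter P? (applyUpTo f n))) ≡ count ((P? ∘ f) ∩? (Q? ∘ f)) n
  length-filter-filter-applyUpTo P? Q? f zero = refl
  length-filter-filter-applyUpTo P? Q? f (suc n) with P? (f 0)
  ... | no _ = length-filter-filter-applyUpTo P? Q? (f ∘ suc) n
  ... | yes _ with Q? (f 0)
  ...   | yes _ = cong suc (length-filter-filter-applyUpTo P? Q? (f ∘ suc) n)
  ...   | no  _ = length-filter-filter-applyUpTo P? Q? (f ∘ suc) n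

  count-cong : ∀ {P : Pred ℕ ℓ} {Q : Pred ℕ ℓ′} (P? : Decidable P) (Q? : Decidable Q) n →
               (∀ {i} → i < n → P i ⇔ Q i) → count P? n ≡ count Q? n
  count-cong P? Q? zero    P⇔Q = refl
  count-cong P? Q? (suc n) P⇔Q with P? 0 | Q? 0
  ... | yes _  | yes _  = cong suc (count-cong (P? ∘ suc) (Q? ∘ suc) n (P⇔Q ∘ s≤s))
  ... | no  _  | no  _  = count-cong (P? ∘ suc) (Q? ∘ suc) n (P⇔Q ∘ s≤s)
  ... | yes p  | no ¬q  = ⊥-elim (¬q (Equivalence.to (P⇔Q (s≤s z≤n)) p))
  ... | no ¬p  | yes q  = ⊥-elim (¬p (Equivalence.from (P⇔Q (s≤s z≤n)) q))

  count-+ : ∀ {P : Pred ℕ ℓ} (P? : Decidable P) m n → count P? (m + n) ≡ count P? m + count (P? ∘ (m +_)) n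
  count-+ P? zero    n = refl
  count-+ P? (suc m) n with P? 0
  ... | yes _ = cong suc (count-+ (P? ∘ suc) m n)
  ... | no  _ = count-+ (P? ∘ suc) m n

  count-none : ∀ {P : Pred ℕ ℓ} (P? : Decidable P) n → (∀ i → i < n → ¬ P i) → count P? n ≡ 0
  count-none P? zero    ¬P = refl
  count-none P? (suc n) ¬P with P? 0
  ... | yes p = ⊥-elim (¬P 0 (s≤s z≤n) p)
  ... | no  _ = count-none (P? ∘ suc) n (λ i i<n → ¬P (suc i) (s≤s i<n))

  count-∩-∁ : ∀ {P : Pred ℕ ℓ} {Q : Pred ℕ ℓ′} (P? : Decidable P) (Q? : Decidable Q) n →
              count P? n ≡ count (P? ∩? Q?) n + count (P? ∩? ∁? Q?) n
  count-∩-∁ P? Q? zero = refl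
  count-∩-∁ P? Q? (suc n) with P? 0 | Q? 0
  ... | yes _ | yes _ = cong suc (count-∩-∁ (P? ∘ suc) (Q? ∘ suc) n)
  ... | yes _ | no  _ = trans (cong suc (count-∩-∁ (P? ∘ suc) (Q? ∘ suc) n)) (sym (+-suc _ _))
  ... | no  _ | _     = count-∩-∁ (P? ∘ suc) (Q? ∘ suc) n

  count-periodic : ∀ {P : Pred ℕ ℓ} (P? : Decidable P) m → (∀ i → P (m + i) ⇔ P i) →
                   ∀ k → count P? (k * m) ≡ k * count P? m
  count-periodic P? m P-periodic zero    = refl
  count-periodic P? m P-periodic (suc k) = begin
    count P? (m + k * m)                         ≡⟨ count-+ P? m (k * m) ⟩
    count P? m + count (P? ∘ (m +_)) (k * m)     ≡⟨ cong (count P? m +_) (count-cong _ P? (k * m) (λ {i} _ → P-periodic i)) ⟩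
    count P? m + count P? (k * m)                ≡⟨ cong (count P? m +_) (count-periodic P? m P-periodic k) ⟩
    count P? m + k * count P? m                  ∎
    where open ≡-Reasoning

  count-multiples : ∀ {P : Pred ℕ ℓ} (P? : Decidable P) r′ k →
                    count (P? ∩? (λ i → suc r′ ∣? suc i)) (k * suc r′) ≡ count (λ j → P? (j * suc r′ + r′)) k
  count-multiples P? r′ zero    = refl
  count-multiples {P = P} P? r′ (suc k) = begin
    count X (r + k * r)                                   ≡⟨ count-+ X r (k * r) ⟩
    count X r + count (X ∘ (r +_)) (k * r)                ≡⟨ cong₂ _+_ first-block (count-cong _ X′ (k * r) (λ _ → shift)) ⟩
    count Y 1 + count X′ (k * r)                          ≡⟨ cong (count Y 1 +_) (count-multiples (P? ∘ (r +_)) r′ k) ⟩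
    count Y 1 + count (λ j → P? (r + (j * r + r′))) k     ≡⟨ cong (count Y 1 +_) (count-cong _ (Y ∘ suc) k (λ {j} _ → reindex j)) ⟩
    count Y 1 + count (Y ∘ suc) k                         ≡⟨ count-+ Y 1 k ⟨
    count Y (suc k)                                       ∎
    where
      open ≡-Reasoning
      r : ℕ
      r = suc r′
      R? : Decidable (λ i → r ∣ suc i)
      R? = λ i → r ∣? suc i
      X : Decidable (λ i → P i × r ∣ suc i)
      X = P? ∩? R?
      X′ : Decidable (λ i → P (r + i) × r ∣ suc i)
      X′ = (P? ∘ (r +_)) ∩? R?
      Y : Decidable (λ j → P (j * r + r′))
      Y = λ j → P? (j * r + r′)

      r∣suc[r+i]⇔r∣suc[i] : ∀ {i} → r ∣ suc (r + i) ⇔ r ∣ suc i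
      r∣suc[r+i]⇔r∣suc[i] {i} = mk⇔ (λ r∣ → ∣m+n∣m⇒∣n (subst (r ∣_) (sym (+-suc r i)) r∣) ∣-refl)
                                    (λ r∣ → subst (r ∣_) (+-suc r i) (∣m∣n⇒∣m+n ∣-refl r∣))

      shift : ∀ {i} → (P (r + i) × r ∣ suc (r + i)) ⇔ (P (r + i) × r ∣ suc i)
      shift = mk⇔ (λ (p , r∣) → p , Equivalence.to r∣suc[r+i]⇔r∣suc[i] r∣)
                  (λ (p , r∣) → p , Equivalence.from r∣suc[r+i]⇔r∣suc[i] r∣)

      reindex : ∀ j → P (r + (j * r + r′)) ⇔ P (suc j * r + r′)
      reindex j = let eq = sym (+-assoc r (j * r) r′) in mk⇔ (subst P eq) (subst P (sym eq))

      first-block : count X r ≡ count Y 1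
      first-block = begin
        count X (suc r′)                       ≡⟨ cong (count X) (+-comm 1 r′) ⟩
        count X (r′ + 1)                       ≡⟨ count-+ X r′ 1 ⟩
        count X r′ + count (X ∘ (r′ +_)) 1     ≡⟨ cong₂ _+_ (count-none X r′ (λ i i<r′ (_ , r∣) → <⇒≱ (s≤s i<r′) (∣⇒≤ r∣)))
                                                          (count-cong (X ∘ (r′ +_)) Y 1 last) ⟩
        count Y 1                              ∎
        where
          last : ∀ {i} → i < 1 → (P (r′ + i) × r ∣ suc (r′ + i)) ⇔ P (i * r + r′)
          last {zero} _ rewrite +-identityʳ r′ = mk⇔ proj₁ (_, ∣-refl)
          last {suc _} (s≤s ())

module DivisorCounting where

  open Primes using (∤⇒coprime; prime≢1)
  open Counting
  open import Data.Nat using (suc; _+_; _*_; _<_; s≤s; NonZero; ≢-nonZero)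
  open import Data.Nat.Properties
  open import Data.Nat.Divisibility
  open import Data.Nat.Coprimality as Coprimality using (Coprime; coprime?; coprime-divisor)
  open import Data.Nat.Primality using (Prime)
  open import Data.List using (filter; length; applyUpTo)
  open import Data.List.Properties using (map-applyUpTo)
  open import Data.Product using (_×_; _,_)
  open import Function using (_∘_; id)
  open import Function.Bundles using (_⇔_; mk⇔; Equivalence)
  open import Relation.Binary.PropositionalEquality
  open import Relation.Nullary using (¬_)
  open import Relation.Unary using (Decidable)
  open import Relation.Unary.Properties using (_∩?_; ∁?)

  τ : ℕ → ℕ
  τ n = length (divisors n)

  range1≡applyUpTo : ∀ n → range1 n ≡ applyUpTo suc n
  range1≡applyUpTo = map-applyUpTo id suc

  -- In the counting forms the index i stands for the number i + 1, as range1 n lists 1, …, n.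
  τ≡count : ∀ n → τ n ≡ count (λ i → suc i ∣? n) n
  τ≡count n = trans (cong (length ∘ filter (_∣? n)) (range1≡applyUpTo n)) (length-filter-applyUpTo (_∣? n) suc n)

  φ≡count : ∀ n → φ n ≡ count (λ i → coprime? (suc i) n) n
  φ≡count n = trans (cong (length ∘ filter (λ i → coprime? i n)) (range1≡applyUpTo n))
                    (length-filter-applyUpTo (λ i → coprime? i n) suc n)

  length-filter-divisors : ∀ q n →
                           length (filter (q ∣?_) (divisors n)) ≡ count ((λ i → suc i ∣? n) ∩? (λ i → q ∣? suc i)) n
  length-filter-divisors q n = trans (cong (length ∘ filter (q ∣?_) ∘ filter (_∣? n)) (range1≡applyUpTo n))
                                     (length-filter-filter-applyUpTo (_∣? n) (q ∣?_) suc n)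

  module _ {r′ m : ℕ} (r-prime : Prime (suc r′)) (r∤m : ¬ suc r′ ∣ m) where

    private
      r N : ℕ
      r = suc r′
      N = m * r

      instance
        m≢0 : NonZero m
        m≢0 = ≢-nonZero λ { refl → r∤m (r ∣0) }

      r⊥m : Coprime r m
      r⊥m = Coprimality.sym (∤⇒coprime r-prime r∤m)

      suc[j*r+r′]≡suc[j]*r : ∀ j → suc (j * r + r′) ≡ suc j * r
      suc[j*r+r′]≡suc[j]*r j = trans (sym (+-suc (j * r) r′)) (+-comm (j * r) r)

      ∣N×∤⇔∣m : ∀ {d} → (d ∣ N × ¬ r ∣ d) ⇔ d ∣ m
      ∣N×∤⇔∣m {d} = mk⇔
        (λ (d∣N , r∤d) → coprime-divisor (∤⇒coprime r-prime r∤d) (subst (d ∣_) (*-comm m r) d∣N))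
        (λ d∣m → ∣m⇒∣m*n r d∣m , λ r∣d → r∤m (∣-trans r∣d d∣m))

      *r∣N⇔∣m : ∀ {d} → d * r ∣ N ⇔ d ∣ m
      *r∣N⇔∣m = mk⇔ (*-cancelʳ-∣ r) (*-monoˡ-∣ r)

      ⊥m×∤⇔⊥N : ∀ {d} → (Coprime d m × ¬ r ∣ d) ⇔ Coprime d N
      ⊥m×∤⇔⊥N {d} = mk⇔
        (λ (d⊥m , r∤d) {e} (e∣d , e∣N) →
          d⊥m (e∣d , coprime-divisor (∤⇒coprime r-prime λ r∣e → r∤d (∣-trans r∣e e∣d))
                                     (subst (e ∣_) (*-comm m r) e∣N)))
        (λ d⊥N → (λ {e} (e∣d , e∣m) → d⊥N (e∣d , ∣m⇒∣m*n r e∣m)) ,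
                 (λ r∣d → prime≢1 r-prime (d⊥N (r∣d , n∣m*n m))))

      *r⊥m⇔⊥m : ∀ {d} → Coprime (d * r) m ⇔ Coprime d m
      *r⊥m⇔⊥m {d} = mk⇔
        (λ dr⊥m {e} (e∣d , e∣m) → dr⊥m (∣m⇒∣m*n r e∣d , e∣m))
        (λ d⊥m {e} (e∣dr , e∣m) →
          d⊥m (coprime-divisor (λ {f} (f∣e , f∣r) → r⊥m (f∣r , ∣-trans f∣e e∣m)) (subst (e ∣_) (*-comm d r) e∣dr) , e∣m))

      D? : Decidable (λ i → suc i ∣ N)
      D? = λ i → suc i ∣? N
      R? : Decidable (λ i → r ∣ suc i)
      R? = λ i → r ∣? suc i
      C? : Decidable (λ i → Coprime (suc i) m)
      C? = λ i → coprime? (suc i) m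

      count-D∩R : count (D? ∩? R?) N ≡ τ m
      count-D∩R = begin
        count (D? ∩? R?) (m * r)                ≡⟨ count-multiples D? r′ m ⟩
        count (λ j → suc (j * r + r′) ∣? N) m    ≡⟨ count-cong _ (λ j → suc j ∣? m) m (λ {j} _ → reindex j) ⟩
        count (λ j → suc j ∣? m) m               ≡⟨ τ≡count m ⟨
        τ m                                      ∎
        where
          open ≡-Reasoning
          reindex : ∀ j → suc (j * r + r′) ∣ N ⇔ suc j ∣ m
          reindex j = let eq = suc[j*r+r′]≡suc[j]*r j in
            mk⇔ (Equivalence.to *r∣N⇔∣m ∘ subst (_∣ N) eq) (subst (_∣ N) (sym eq) ∘ Equivalence.from *r∣N⇔∣m)

      count-D∩∁R : count (D? ∩? ∁? R?) N ≡ τ m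
      count-D∩∁R = begin
        count (D? ∩? ∁? R?) N                                   ≡⟨ count-cong _ M? N (λ _ → ∣N×∤⇔∣m) ⟩
        count M? (m * suc r′)                                   ≡⟨ cong (count M?) (*-suc m r′) ⟩
        count M? (m + m * r′)                                   ≡⟨ count-+ M? m (m * r′) ⟩
        count M? m + count (M? ∘ (m +_)) (m * r′)               ≡⟨ cong (count M? m +_) (count-none _ (m * r′) beyond-m) ⟩
        count M? m + 0                                          ≡⟨ +-identityʳ _ ⟩
        count M? m                                              ≡⟨ τ≡count m ⟨
        τ m                                                     ∎
        where
          open ≡-Reasoning
          M? : Decidable (λ i → suc i ∣ m)
          M? = λ i → suc i ∣? m
          beyond-m : ∀ i → i < m * r′ → ¬ suc (m + i) ∣ m
          beyond-m i _ d∣m = <⇒≱ (s≤s (m≤m+n m i)) (∣⇒≤ d∣m)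

      count-C∩R : count (C? ∩? R?) N ≡ φ m
      count-C∩R = begin
        count (C? ∩? R?) (m * r)                       ≡⟨ count-multiples C? r′ m ⟩
        count (λ j → coprime? (suc (j * r + r′)) m) m   ≡⟨ count-cong _ C? m (λ {j} _ → reindex j) ⟩
        count C? m                                      ≡⟨ φ≡count m ⟨
        φ m                                             ∎
        where
          open ≡-Reasoning
          reindex : ∀ j → Coprime (suc (j * r + r′)) m ⇔ Coprime (suc j) m
          reindex j = let eq = suc[j*r+r′]≡suc[j]*r j in
            mk⇔ (Equivalence.to *r⊥m⇔⊥m ∘ subst (λ d → Coprime d m) eq)
                (subst (λ d → Coprime d m) (sym eq) ∘ Equivalence.from *r⊥m⇔⊥m)

      count-C∩∁R : count (C? ∩? ∁? R?) N ≡ φ N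
      count-C∩∁R = trans (count-cong _ _ N (λ _ → ⊥m×∤⇔⊥N)) (sym (φ≡count N))

      C-periodic : ∀ i → Coprime (suc (m + i)) m ⇔ Coprime (suc i) m
      C-periodic i = mk⇔ (λ c {e} (e∣x , e∣m) → c (subst (e ∣_) (+-suc m i) (∣m∣n⇒∣m+n e∣m e∣x) , e∣m))
                         (λ c {e} (e∣x , e∣m) → c (∣m+n∣m⇒∣n (subst (e ∣_) (sym (+-suc m i)) e∣x) e∣m , e∣m))

    length-filter-∣-divisors : length (filter (r ∣?_) (divisors N)) ≡ τ m
    length-filter-∣-divisors = trans (length-filter-divisors r N) count-D∩R

    τ-* : τ N ≡ τ m + τ m
    τ-* = trans (τ≡count N) (trans (count-∩-∁ D? R? N) (cong₂ _+_ count-D∩R count-D∩∁R))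

    φ-* : φ N ≡ r′ * φ m
    φ-* = +-cancelˡ-≡ (φ m) (φ N) (r′ * φ m) (begin
      φ m + φ N                                       ≡⟨ cong₂ _+_ count-C∩R count-C∩∁R ⟨
      count (C? ∩? R?) N + count (C? ∩? ∁? R?) N      ≡⟨ count-∩-∁ C? R? N ⟨
      count C? (m * r)                                ≡⟨ cong (count C?) (*-comm m r) ⟩
      count C? (r * m)                                ≡⟨ count-periodic C? m C-periodic r ⟩
      r * count C? m                                  ≡⟨ cong (r *_) (φ≡count m) ⟨
      r * φ m                                         ∎)
      where open ≡-Reasoning

module SquareFreeNumbers where

  open Primes
  open DivisorCounting
  open import Data.Nat using (zero; suc; _+_; _*_; _^_; _∸_; _≤_; _<_; _≟_; >-nonZero)
  open import Data.Nat.Properties using (m<m*n; +-identityʳ; n≢0⇒n>0)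
  open import Data.Nat.Induction using (<-rec)
  open import Data.Nat.Divisibility
  open import Data.Nat.Primality using (Prime; euclidsLemma; prime⇒nonTrivial)
  open import Data.Nat.Base using (nonTrivial⇒n>1)
  open import Data.List using (filter; length)
  open import Data.Product using (∃-syntax; _×_; _,_)
  open import Data.Sum using (inj₁; inj₂)
  open import Data.Empty using (⊥-elim)
  open import Relation.Nullary using (¬_; yes; no)
  open import Relation.Binary.PropositionalEquality

  squareFree-split : ∀ {n r} → SquareFree n → Prime r → r ∣ n → ∃[ m ] n ≡ m * r × ¬ r ∣ m × SquareFree m
  squareFree-split {n} {r} n-sf r-prime (divides m n≡m*r) = m , n≡m*r , r∤m , m-sf
    where
      r∤m : ¬ r ∣ m
      r∤m r∣m = prime≢1 r-prime (n-sf r (subst (r * r ∣_) (sym n≡m*r) (*-monoˡ-∣ r r∣m)))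
      m-sf : SquareFree m
      m-sf d d*d∣m = n-sf d (subst (d * d ∣_) (sym n≡m*r) (∣m⇒∣m*n r d*d∣m))

  squareFree-induction : ∀ {ℓ} (P : ℕ → Set ℓ) → P 1 →
                         (∀ {m r} → Prime r → ¬ r ∣ m → SquareFree m → P m → P (m * r)) →
                         ∀ {n} → 1 ≤ n → SquareFree n → P n
  squareFree-induction P P[1] P[m*r] {n} = <-rec (λ n → 1 ≤ n → SquareFree n → P n) step n
    where
      step : ∀ n → (∀ {m} → m < n → 1 ≤ m → SquareFree m → P m) → 1 ≤ n → SquareFree n → P n
      step n rec 1≤n n-sf with n ≟ 1
      ... | yes refl = P[1]
      ... | no n≢1 with prime-factor n {{>-nonZero 1≤n}} n≢1
      ...   | r , r-prime , r∣n with squareFree-split n-sf r-prime r∣n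
      ...     | m , n≡m*r , r∤m , m-sf = subst P (sym n≡m*r) (P[m*r] r-prime r∤m m-sf (rec m<n 1≤m m-sf))
        where
          1≤m : 1 ≤ m
          1≤m = n≢0⇒n>0 λ { refl → r∤m (r ∣0) }
          m<n : m < n
          m<n = subst (m <_) (sym n≡m*r) (m<m*n m r {{>-nonZero 1≤m}} (nonTrivial⇒n>1 r {{prime⇒nonTrivial r-prime}}))

  τ≡2^ : ∀ {n} → 1 ≤ n → SquareFree n → ∃[ k ] τ n ≡ 2 ^ k
  τ≡2^ = squareFree-induction (λ n → ∃[ k ] τ n ≡ 2 ^ k) (0 , refl) step
    where
      step : ∀ {m r} → Prime r → ¬ r ∣ m → SquareFree m → ∃[ k ] τ m ≡ 2 ^ k → ∃[ k ] τ (m * r) ≡ 2 ^ k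
      step {r = suc _} r-prime r∤m _ (k , τm≡2^k) =
        suc k , trans (τ-* r-prime r∤m) (trans (cong (λ t → t + t) τm≡2^k) (cong (2 ^ k +_) (sym (+-identityʳ (2 ^ k)))))

  prime∣2^k⇒≤2 : ∀ {p} → Prime p → ∀ k → p ∣ 2 ^ k → p ≤ 2
  prime∣2^k⇒≤2 p-prime zero    p∣1   = ⊥-elim (prime≢1 p-prime (∣1⇒≡1 p∣1))
  prime∣2^k⇒≤2 p-prime (suc k) p∣2^k with euclidsLemma 2 (2 ^ k) p-prime p∣2^k
  ... | inj₁ p∣2 = ∣⇒≤ p∣2
  ... | inj₂ p∣2^k-1 = prime∣2^k⇒≤2 p-prime k p∣2^k-1

  ∣φ⇒∣p∸1 : ∀ {n q} → 1 ≤ n → SquareFree n → Prime q → q ∣ φ n → ∃[ p ] Prime p × p ∣ n × q ∣ p ∸ 1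
  ∣φ⇒∣p∸1 {q = q} 1≤n n-sf q-prime = squareFree-induction P P[1] step 1≤n n-sf
    where
      P : ℕ → Set
      P n = q ∣ φ n → ∃[ p ] Prime p × p ∣ n × q ∣ p ∸ 1

      P[1] : P 1
      P[1] q∣1 = ⊥-elim (prime≢1 q-prime (∣1⇒≡1 q∣1))

      step : ∀ {m r} → Prime r → ¬ r ∣ m → SquareFree m → P m → P (m * r)
      step {m} {r@(suc r′)} r-prime r∤m _ P[m] q∣φ[m*r]
        with euclidsLemma r′ (φ m) q-prime (subst (q ∣_) (φ-* r-prime r∤m) q∣φ[m*r])
      ... | inj₁ q∣r′ = r , r-prime , n∣m*n m , q∣r′
      ... | inj₂ q∣φm with P[m] q∣φm
      ...   | p , p-prime , p∣m , q∣p∸1 = p , p-prime , ∣m⇒∣m*n r p∣m , q∣p∸1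

  length-filter-∣-divisors≡2^ : ∀ {n q} → SquareFree n → Prime q → q ∣ n →
                                ∃[ k ] length (filter (q ∣?_) (divisors n)) ≡ 2 ^ k
  length-filter-∣-divisors≡2^ {n} {q@(suc _)} n-sf q-prime q∣n with squareFree-split n-sf q-prime q∣n
  ... | m , n≡m*q , q∤m , m-sf with τ≡2^ (n≢0⇒n>0 λ { refl → q∤m (q ∣0) }) m-sf
  ...   | k , τm≡2^k = k , trans (cong (λ n → length (filter (q ∣?_) (divisors n))) n≡m*q)
                                 (trans (length-filter-∣-divisors q-prime q∤m) τm≡2^k)

open Primes
open Congruence
open Fermat using (x^[p∸1]≡1)
open FiniteDifferences using (DegreeBelow-const; monic-no-consecutive-roots)
open RootsOfUnity using (module PrimeOrderRoot; powerSum)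
open DivisorCounting using (τ)
open SquareFreeNumbers
open import Data.Nat using (zero; suc; _*_; _∸_; _≤_; _<_; s≤s; z≤n; >-nonZero)
open import Data.Nat.Properties using (m<m*n; m≤n*m; <⇒≱; ≤-trans; m<n⇒m<1+n)
open import Data.Nat.Divisibility using (_∣_; _∣?_; divides; ∣-trans; ∣⇒≤)
open import Data.Nat.Coprimality using (coprime⇒gcd≡1)
open import Data.Nat.Primality using (Prime; euclidsLemma; prime⇒nonTrivial)
open import Data.Nat.Base using (nonTrivial⇒n>1)
open import Data.Integer using (+_; _-_; -_; _^_; 0ℤ; 1ℤ)
import Data.Integer as ℤ using (_*_)
import Data.Integer.Properties as ℤ
import Data.Integer.Divisibility.Signed as ℤ
open import Data.List using (filter; length)
open import Data.Product using (_,_)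
open import Data.Sum using (inj₁; inj₂)
open import Data.Empty using (⊥-elim)
open import Function using (_∘_)
open import Relation.Nullary using (¬_; yes; no)
open import Relation.Binary.PropositionalEquality using (sym; trans; cong; subst)

q-th-roots-trivial : ∀ {n p q y} → WeaklyAlmostPrime n → Prime p → p ∣ n → Prime q →
                     ¬ p ∣ q * length (filter (q ∣?_) (divisors n)) → y ^ q ≡ 1ℤ mod p → y ≡ 1ℤ mod p
q-th-roots-trivial {n} {p} {q} {y} (_ , n∣T) p-prime p∣n q-prime p∤q*c y^q≡1 with + p ℤ.∣? y - 1ℤ
... | yes p∣y-1 = mk≡mod p∣y-1
... | no  p∤y-1 = ⊥-elim (p∤q*c (subst (p ∣_) (ℤ.abs-* (+ q) (+ c)) (ℤ.∣⇒∣ᵤ (≡0-mod⇒∣ q*c≡0))))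
  where
    open PrimeOrderRoot p-prime q-prime y^q≡1 (p∤y-1 ∘ ∣difference)
    c : ℕ
    c = length (filter (q ∣?_) (divisors n))
    T≡0 : ∀ j → powerSum (divisors n) (y ^ j) ≡ + τ n ℤ.* y ^ j mod p
    T≡0 j = mk≡mod (ℤ.∣ᵤ⇒∣ (∣-trans p∣n (n∣T (y ^ j))))
    q*c≡0 : + q ℤ.* + c ≡ 0ℤ mod p
    q*c≡0 = roots-of-unity-filter (divisors n) T≡0

q∤p∸1 : ∀ {n p q} → AlmostPrime n → Prime p → p ∣ n → Prime q → q ∣ n → ¬ q ∣ p ∸ 1
q∤p∸1 {p = suc p′} _ p-prime _ _ _ (divides zero p′≡0) = prime≢1 p-prime (cong suc p′≡0)
q∤p∸1 {n} {p@(suc p′)} {q@(suc _)} (n-wap , n-sf) p-prime p∣n q-prime q∣n (divides e@(suc e′) p′≡e*q) =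
  monic-no-consecutive-roots {h = λ _ → - 1ℤ} p-prime e<p (DegreeBelow-const e′ (- 1ℤ)) 1ℤ
    λ i i≤e → ∣difference (x^e≡1 (suc i) (s≤s z≤n) (s≤s i≤e))
  where
    1<q : 1 < q
    1<q = nonTrivial⇒n>1 q {{prime⇒nonTrivial q-prime}}

    e<p′ : e < p′
    e<p′ = subst (e <_) (sym p′≡e*q) (m<m*n e q 1<q)

    e<p : e < p
    e<p = m<n⇒m<1+n e<p′

    q<p : q < p
    q<p = s≤s (subst (q ≤_) (sym p′≡e*q) (m≤n*m q e))

    2<p : 2 < p
    2<p = ≤-trans (s≤s 1<q) q<p

    p∤q*c : ¬ p ∣ q * length (filter (q ∣?_) (divisors n))
    p∤q*c p∣q*c with length-filter-∣-divisors≡2^ n-sf q-prime q∣n | euclidsLemma q _ p-prime p∣q*c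
    ... | _ , _       | inj₁ p∣q = <⇒≱ q<p (∣⇒≤ p∣q)
    ... | k , c≡2^k   | inj₂ p∣c = <⇒≱ 2<p (prime∣2^k⇒≤2 p-prime k (subst (p ∣_) c≡2^k p∣c))

    x^e≡1 : ∀ x → 0 < x → x ≤ suc e → (+ x) ^ e ≡ 1ℤ mod p
    x^e≡1 x 0<x x≤e+1 = q-th-roots-trivial n-wap p-prime p∣n q-prime p∤q*c [x^e]^q≡1
      where
        p∤x : ¬ p ∣ x
        p∤x p∣x = <⇒≱ (s≤s (≤-trans x≤e+1 e<p′)) (∣⇒≤ {{>-nonZero 0<x}} p∣x)
        [x^e]^q≡1 : ((+ x) ^ e) ^ q ≡ 1ℤ mod p
        [x^e]^q≡1 = ≡-mod-trans (≡-mod-reflexive (trans (ℤ.^-*-assoc (+ x) e q) (cong ((+ x) ^_) (sym p′≡e*q))))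
                                (x^[p∸1]≡1 p-prime p∤x)

corollary2p4 : (n : ℕ) → AlmostPrime n → gcd n (φ n) ≡ 1
corollary2p4 n n-almostPrime@((1≤n , _) , n-sf) = coprime⇒gcd≡1 (¬common-prime⇒coprime 1≤n no-common-prime)
  where
    no-common-prime : ∀ {q} → Prime q → q ∣ n → ¬ q ∣ φ n
    no-common-prime q-prime q∣n q∣φn with ∣φ⇒∣p∸1 1≤n n-sf q-prime q∣φn
    ... | p , p-prime , p∣n , q∣p∸1 = q∤p∸1 n-almostPrime p-prime p∣n q-prime q∣n q∣p∸1
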